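{- Let $G$ and $H$ be weighted graphs on the same vertex set $V$, and let $H$ be a $\beta$-approximate emulator of $G$. Then any $\alpha$-approximate dual-only preconditioner for $H$ is an $(\alpha\cdot\beta)$-approximate dual-only preconditioner for $G$.
   Context: For a weighted undirected graph $G=(V,E)$ with $V=\{v_1,\dots,v_n\}$, orient edges as $\vec E=\{(v_i,v_j):\{v_i,v_j\}\in E,\ i<j\}$; the incidence matrix $B_G\in\{ -1,0,1\}^{V\times\vec E}$ has, for $e=(s,t)$, entries $1$ at $s$, $-1$ at $t$, and $0$ elsewhere; $W_G$ is the diagonal matrix of the positive edge weights $w(e)\ge 1$. A demand $d\in\mathbb{R}^V$ is proper if $\sum_vd_v=0$; a flow $f\in\mathbb{R}^{\vec E}$ routes $d$ if $B_Gf=d$ and has cost $\|W_Gf\|_1$. An $\alpha$-approximate dual-only preconditioner for $G$ is a function mapping every proper demand $d$ to potentials $\phi\in\mathbb{R}^V$ such that $\|W_G^{ -1}B_G^T\phi\|_\infty\le\alpha$ and there exists a flow $f$ in $G$ with $B_Gf=d$ and $\|W_Gf\|_1\le\langle d,\phi\rangle$. A weighted graph $H=(V,E_H)$ on the same vertex set is a $\beta$-approximate emulator of $G$ if $\mathrm{dist}_G(u,v)\le\mathrm{dist}_H(u,v)\le\beta\cdot\mathrm{dist}_G(u,v)$ for all $u,v\in V$, where $\mathrm{dist}$ denotes weighted shortest-path distance.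
   Formalization: The edge weights, demands, potentials and flows, as well as the parameters α and β, are all taken in ℚ instead of ℝ. -}

module Defs where

open import Data.Nat using (ℕ; zero; suc)
open import Data.Fin using (Fin; zero; suc; _≟_) renaming (_<_ to _<ᶠ_)
open import Data.Integer using (+<+)
open import Data.Nat using (s≤s; z≤n)
open import Data.Rational
  using (ℚ; 0ℚ; 1ℚ; _+_; _*_; -_; _-_; ∣_∣; _≤_; _<_; 1/_; *<*; >-nonZero)
open import Data.Rational.Properties using (<-≤-trans)
open import Data.Product using (Σ; _×_)
open import Data.Empty using (⊥)
open import Relation.Nullary using (does)
open import Data.Bool using (if_then_else_)
open import Relation.Binary.PropositionalEquality using (_≡_)

Σᶠ : (k : ℕ) → (Fin k → ℚ) → ℚ
Σᶠ zero    f = 0ℚ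
Σᶠ (suc k) f = f zero + Σᶠ k (λ i → f (suc i))

-- Weighted undirected graphs on vertex set V = Fin n (v_1,…,v_n ↦ 0,…,n-1).
-- The (undirected, simple) edge set E is listed as Fin m; edge e is
-- {src e, tgt e} oriented as (src e, tgt e) with src e < tgt e, so the
-- list of oriented edges is exactly E⃗.

record WGraph (n : ℕ) : Set where
  field
    m       : ℕ
    src     : Fin m → Fin n
    tgt     : Fin m → Fin n
    src<tgt : ∀ e → src e <ᶠ tgt e
    simple  : ∀ e e′ → src e ≡ src e′ → tgt e ≡ tgt e′ → e ≡ e′
    w       : Fin m → ℚ
    w≥1     : ∀ e → 1ℚ ≤ w e

open WGraph public

Vec⟨V⟩ : ℕ → Set
Vec⟨V⟩ n = Fin n → ℚ

Vec⟨E⟩ : ∀ {n} → WGraph n → Set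
Vec⟨E⟩ G = Fin (m G) → ℚ

B : ∀ {n} (G : WGraph n) → Fin n → Fin (m G) → ℚ
B G v e =
  if does (src G e ≟ v) then 1ℚ
  else if does (tgt G e ≟ v) then - 1ℚ
  else 0ℚ

Bf : ∀ {n} (G : WGraph n) → Vec⟨E⟩ G → Vec⟨V⟩ n
Bf {n} G f v = Σᶠ (m G) (λ e → B G v e * f e)

Bᵀφ : ∀ {n} (G : WGraph n) → Vec⟨V⟩ n → Vec⟨E⟩ G
Bᵀφ {n} G φ e = Σᶠ n (λ v → B G v e * φ v)

winv : ∀ {n} (G : WGraph n) → Fin (m G) → ℚ
winv G e = 1/_ (w G e) {{>-nonZero (<-≤-trans (*<* (+<+ (s≤s z≤n))) (w≥1 G e))}}

W⁻¹ : ∀ {n} (G : WGraph n) → Vec⟨E⟩ G → Vec⟨E⟩ G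
W⁻¹ G x e = winv G e * x e

∥_∥∞≤_ : ∀ {k} → (Fin k → ℚ) → ℚ → Set
∥ x ∥∞≤ α = ∀ i → ∣ x i ∣ ≤ α

cost : ∀ {n} (G : WGraph n) → Vec⟨E⟩ G → ℚ
cost G f = Σᶠ (m G) (λ e → ∣ w G e * f e ∣)

⟨_,_⟩ : ∀ {n} → Vec⟨V⟩ n → Vec⟨V⟩ n → ℚ
⟨_,_⟩ {n} d φ = Σᶠ n (λ v → d v * φ v)

Proper : ∀ {n} → Vec⟨V⟩ n → Set
Proper {n} d = Σᶠ n d ≡ 0ℚ

Routes : ∀ {n} (G : WGraph n) → Vec⟨E⟩ G → Vec⟨V⟩ n → Set
Routes G f d = ∀ v → Bf G f v ≡ d v

Precond : ℕ → Set
Precond n = (d : Vec⟨V⟩ n) → Proper d → Vec⟨V⟩ n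

IsDualOnlyPrecond : ∀ {n} → WGraph n → ℚ → Precond n → Set
IsDualOnlyPrecond {n} G α P =
  ∀ (d : Vec⟨V⟩ n) (pd : Proper d) →
    (∥ W⁻¹ G (Bᵀφ G (P d pd)) ∥∞≤ α)
    × Σ (Vec⟨E⟩ G) (λ f → Routes G f d × (cost G f ≤ ⟨ d , P d pd ⟩))

data Walk {n} (G : WGraph n) : Fin n → Fin n → Set where
  []    : ∀ {u} → Walk G u u
  fwd∷_ : ∀ {e v} → Walk G (tgt G e) v → Walk G (src G e) v
  bwd∷_ : ∀ {e v} → Walk G (src G e) v → Walk G (tgt G e) v

len : ∀ {n} {G : WGraph n} {u v} → Walk G u v → ℚ
len []                 = 0ℚ
len {G = G} (fwd∷_ {e} p) = w G e + len p
len {G = G} (bwd∷_ {e} p) = w G e + len p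

data ℚ∞ : Set where
  fin : ℚ → ℚ∞
  ∞   : ℚ∞

data _≤∞_ : ℚ∞ → ℚ∞ → Set where
  fin≤fin : ∀ {p q} → p ≤ q → fin p ≤∞ fin q
  _≤∞∞    : ∀ x → x ≤∞ ∞

-- scaling by β (used for β ≥ 1 > 0, so β · ∞ = ∞)
_·∞_ : ℚ → ℚ∞ → ℚ∞
β ·∞ fin q = fin (β * q)
β ·∞ ∞     = ∞

IsDist : ∀ {n} → WGraph n → Fin n → Fin n → ℚ∞ → Set
IsDist G u v (fin c) =
  Σ (Walk G u v) (λ p → len p ≡ c) × (∀ (p : Walk G u v) → c ≤ len p)
IsDist G u v ∞ = Walk G u v → ⊥

IsEmulator : ∀ {n} → ℚ → WGraph n → WGraph n → Set
IsEmulator {n} β G H =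
  ∀ (u v : Fin n) (δG δH : ℚ∞) → IsDist G u v δG → IsDist H u v δH →
    (δG ≤∞ δH) × (δH ≤∞ (β ·∞ δG))

{-# OPTIONS --safe #-}
module Submission where

-- A potential φ satisfies ∥W⁻¹Bᵀφ∥∞ ≤ α exactly when it is α-Lipschitz across every edge, hence
-- along every walk.  Each edge of G is stretched by at most β into a walk of H, so an
-- α-Lipschitz potential for H is αβ-Lipschitz for G.  On the flow side each edge of H is replaced
-- by a G-walk that is no longer; sending the flow of every H-edge along its G-walk gives a G-flow
-- with the same demand and no larger cost.  The emulator hypothesis is phrased through shortest-path
-- distances, which exist because weights are ≥ 1: only finitely many walks have bounded length.

open import Defs
open import Algebra.Bundles using (CommutativeRing)
open import Relation.Binary.Bundles using (DecTotalOrder)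
open import Data.Nat as ℕ using (ℕ; zero; suc; s≤s)
import Data.Nat.Properties as ℕ
import Data.Integer as ℤ
import Data.Integer.Properties as ℤ
import Data.Integer.Solver
open import Data.Rational
  using (ℚ; mkℚ; 0ℚ; 1ℚ; _+_; _*_; -_; _-_; ∣_∣; _≤_; _<_; toℚᵘ; nonNegative; positive; >-nonZero)
open import Data.Rational.Properties as ℚ using (≤-refl; ≤-trans; ≤-reflexive; +-mono-≤)
open import Data.Rational.Unnormalised as ℚᵘ using (mkℚᵘ; _≃_; *≡*; *<*)
import Data.Rational.Unnormalised.Properties as ℚᵘ
import Data.Rational.Solver
open import Data.Fin using (Fin; zero; suc; _≟_)
open import Data.Fin.Properties using (<⇒≢)
open import Data.Product using (Σ; ∃; _×_; _,_; proj₁; proj₂)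
open import Data.Sum using (inj₁; inj₂)
open import Data.Bool using (true; false; if_then_else_)
open import Data.Empty using (⊥-elim)
open import Data.List using (List; []; [_]; _++_; map; concatMap; allFin)
open import Data.List.Relation.Unary.Any as Any using (here; any?)
import Data.List.Relation.Unary.All as All
open import Data.List.Membership.Propositional using (_∈_; lose)
open import Data.List.Membership.Propositional.Properties
  using (∈-++⁺ˡ; ∈-++⁺ʳ; ∈-map⁺; ∈-concatMap⁺; ∈-allFin)
open import Data.List.Extrema (DecTotalOrder.totalOrder ℚ.≤-decTotalOrder)
  using (argmin; f[argmin]≤f[⊤]; f[argmin]≤f[xs])
open import Function using (_∘_; _⇔_; mk⇔; Equivalence)
open import Relation.Nullary using (Dec; yes; no; does; ¬_)
open import Relation.Nullary.Decidable using (map′; decidable-stable)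
open import Relation.Binary.PropositionalEquality
  using (_≡_; _≢_; refl; sym; trans; cong; cong₂; subst; module ≡-Reasoning)
open import Algebra.Properties.Semiring.Sum (CommutativeRing.semiring ℚ.+-*-commutativeRing)
  using (sum; sum-cong-≗; ∑-distrib-+; ∑-comm; *-distribˡ-sum; sum-replicate-zero)

module ℚ-Solver = Data.Rational.Solver.+-*-Solver
module ℤ-Solver = Data.Integer.Solver.+-*-Solver

Σᶠ≡sum : ∀ k (f : Fin k → ℚ) → Σᶠ k f ≡ sum f
Σᶠ≡sum zero    f = refl
Σᶠ≡sum (suc k) f = cong (f zero +_) (Σᶠ≡sum k (f ∘ suc))

Σᶠ-cong : ∀ k {f g : Fin k → ℚ} → (∀ i → f i ≡ g i) → Σᶠ k f ≡ Σᶠ k g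
Σᶠ-cong k {f} {g} f≗g = begin
  Σᶠ k f  ≡⟨ Σᶠ≡sum k f ⟩
  sum f   ≡⟨ sum-cong-≗ f≗g ⟩
  sum g   ≡⟨ Σᶠ≡sum k g ⟨
  Σᶠ k g  ∎
  where open ≡-Reasoning

Σᶠ-zero : ∀ k → Σᶠ k (λ _ → 0ℚ) ≡ 0ℚ
Σᶠ-zero k = trans (Σᶠ≡sum k _) (sum-replicate-zero k)

Σᶠ-distrib-+ : ∀ k (f g : Fin k → ℚ) → Σᶠ k (λ i → f i + g i) ≡ Σᶠ k f + Σᶠ k g
Σᶠ-distrib-+ k f g = begin
  Σᶠ k (λ i → f i + g i)  ≡⟨ Σᶠ≡sum k _ ⟩
  sum (λ i → f i + g i)   ≡⟨ ∑-distrib-+ f g ⟩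
  sum f + sum g           ≡⟨ cong₂ _+_ (Σᶠ≡sum k f) (Σᶠ≡sum k g) ⟨
  Σᶠ k f + Σᶠ k g         ∎
  where open ≡-Reasoning

Σᶠ-neg : ∀ k (f : Fin k → ℚ) → Σᶠ k (λ i → - f i) ≡ - Σᶠ k f
Σᶠ-neg zero    f = refl
Σᶠ-neg (suc k) f =
  trans (cong (- f zero +_) (Σᶠ-neg k (f ∘ suc))) (sym (ℚ.neg-distrib-+ (f zero) _))

Σᶠ-distrib‿- : ∀ k (f g : Fin k → ℚ) → Σᶠ k (λ i → f i - g i) ≡ Σᶠ k f - Σᶠ k g
Σᶠ-distrib‿- k f g =
  trans (Σᶠ-distrib-+ k f (λ i → - g i)) (cong (Σᶠ k f +_) (Σᶠ-neg k g))

*-distribˡ-Σᶠ : ∀ k c (f : Fin k → ℚ) → c * Σᶠ k f ≡ Σᶠ k (λ i → c * f i)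
*-distribˡ-Σᶠ k c f = begin
  c * Σᶠ k f            ≡⟨ cong (c *_) (Σᶠ≡sum k f) ⟩
  c * sum f             ≡⟨ *-distribˡ-sum c f ⟩
  sum (λ i → c * f i)   ≡⟨ Σᶠ≡sum k _ ⟨
  Σᶠ k (λ i → c * f i)  ∎
  where open ≡-Reasoning

Σᶠ-comm : ∀ k l (f : Fin k → Fin l → ℚ) →
          Σᶠ k (λ i → Σᶠ l (f i)) ≡ Σᶠ l (λ j → Σᶠ k (λ i → f i j))
Σᶠ-comm k l f = begin
  Σᶠ k (λ i → Σᶠ l (f i))          ≡⟨ Σᶠ-cong k (λ i → Σᶠ≡sum l (f i)) ⟩
  Σᶠ k (λ i → sum (f i))           ≡⟨ Σᶠ≡sum k _ ⟩
  sum (λ i → sum (f i))            ≡⟨ ∑-comm f ⟩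
  sum (λ j → sum (λ i → f i j))    ≡⟨ Σᶠ≡sum l _ ⟨
  Σᶠ l (λ j → sum (λ i → f i j))   ≡⟨ Σᶠ-cong l (λ j → Σᶠ≡sum k (λ i → f i j)) ⟨
  Σᶠ l (λ j → Σᶠ k (λ i → f i j))  ∎
  where open ≡-Reasoning

Σᶠ-mono-≤ : ∀ k {f g : Fin k → ℚ} → (∀ i → f i ≤ g i) → Σᶠ k f ≤ Σᶠ k g
Σᶠ-mono-≤ zero    f≤g = ≤-refl
Σᶠ-mono-≤ (suc k) f≤g = +-mono-≤ (f≤g zero) (Σᶠ-mono-≤ k (f≤g ∘ suc))

∣Σᶠ∣≤Σᶠ∣∣ : ∀ k (f : Fin k → ℚ) → ∣ Σᶠ k f ∣ ≤ Σᶠ k (λ i → ∣ f i ∣)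
∣Σᶠ∣≤Σᶠ∣∣ zero    f = ≤-refl
∣Σᶠ∣≤Σᶠ∣∣ (suc k) f = ≤-trans (ℚ.∣p+q∣≤∣p∣+∣q∣ (f zero) _)
                              (+-mono-≤ (≤-refl {∣ f zero ∣}) (∣Σᶠ∣≤Σᶠ∣∣ k (f ∘ suc)))

δ : ∀ {k} → Fin k → Fin k → ℚ
δ a i = if does (a ≟ i) then 1ℚ else 0ℚ

∣δ∣ : ∀ {k} (a i : Fin k) → ∣ δ a i ∣ ≡ δ a i
∣δ∣ a i with does (a ≟ i)
... | true  = refl
... | false = refl

Σᶠ-δ : ∀ k (a : Fin k) (f : Fin k → ℚ) → Σᶠ k (λ i → f i * δ a i) ≡ f a
Σᶠ-δ (suc k) zero f = begin
  f zero * 1ℚ + Σᶠ k (λ i → f (suc i) * 0ℚ)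
    ≡⟨ cong (f zero * 1ℚ +_) (trans (Σᶠ-cong k (ℚ.*-zeroʳ ∘ f ∘ suc)) (Σᶠ-zero k)) ⟩
  f zero * 1ℚ + 0ℚ
    ≡⟨ solve 1 (λ x → x :* con 1ℚ :+ con 0ℚ := x) refl (f zero) ⟩
  f zero ∎
  where
  open ≡-Reasoning
  open ℚ-Solver
Σᶠ-δ (suc k) (suc a) f = begin
  f zero * 0ℚ + Σᶠ k (λ i → f (suc i) * δ a i)
    ≡⟨ cong (f zero * 0ℚ +_) (Σᶠ-δ k a (f ∘ suc)) ⟩
  f zero * 0ℚ + f (suc a)
    ≡⟨ solve 2 (λ x y → x :* con 0ℚ :+ y := y) refl (f zero) (f (suc a)) ⟩
  f (suc a) ∎
  where
  open ≡-Reasoning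
  open ℚ-Solver

ℕtoℚ : ℕ → ℚ
ℕtoℚ zero    = 0ℚ
ℕtoℚ (suc k) = 1ℚ + ℕtoℚ k

ℕtoℚ-nonNeg : ∀ k → 0ℚ ≤ ℕtoℚ k
ℕtoℚ-nonNeg zero    = ≤-refl
ℕtoℚ-nonNeg (suc k) = +-mono-≤ {0ℚ} (ℚ.nonNegative⁻¹ 1ℚ) (ℕtoℚ-nonNeg k)

ℕtoℚ-mono-≤ : ∀ {a b} → a ℕ.≤ b → ℕtoℚ a ≤ ℕtoℚ b
ℕtoℚ-mono-≤ {b = b} ℕ.z≤n     = ℕtoℚ-nonNeg b
ℕtoℚ-mono-≤         (s≤s a≤b) = +-mono-≤ (≤-refl {1ℚ}) (ℕtoℚ-mono-≤ a≤b)

ℕtoℚ-cancel-< : ∀ {a b} → ℕtoℚ a < ℕtoℚ b → a ℕ.< b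
ℕtoℚ-cancel-< {a} {b} a<b = decidable-stable (a ℕ.<? b)
  (λ a≮b → ℚ.<-irrefl refl (ℚ.<-≤-trans a<b (ℕtoℚ-mono-≤ (ℕ.≮⇒≥ a≮b))))

toℚᵘ-ℕtoℚ : ∀ k → toℚᵘ (ℕtoℚ k) ≃ mkℚᵘ (ℤ.+ k) 0
toℚᵘ-ℕtoℚ zero    = ℚᵘ.≃-refl
toℚᵘ-ℕtoℚ (suc k) = ℚᵘ.≃-trans (ℚ.toℚᵘ-homo-+ 1ℚ (ℕtoℚ k))
  (ℚᵘ.≃-trans (ℚᵘ.+-congʳ (toℚᵘ 1ℚ) (toℚᵘ-ℕtoℚ k))
              (*≡* (solve 1 (λ x → (one :* one :+ x :* one) :* one := (one :+ x) :* one) refl (ℤ.+ k))))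
  where
  open ℤ-Solver
  one = con (ℤ.+ 1)

archimedean : ∀ q → ∃ λ N → q < ℕtoℚ N
archimedean q@(mkℚ ℤ.-[1+ _ ] _ _) = 0 , ℚ.negative⁻¹ q
archimedean (mkℚ (ℤ.+ n) d _) =
  suc n , ℚ.toℚᵘ-cancel-< (ℚᵘ.<-respʳ-≃ (ℚᵘ.≃-sym (toℚᵘ-ℕtoℚ (suc n))) (*<* n<1+n))
  where
  n<1+n : ℤ.+ n ℤ.* ℤ.+ 1 ℤ.< ℤ.+ suc n ℤ.* ℤ.+ suc d
  n<1+n = subst (ℤ._< ℤ.+ suc n ℤ.* ℤ.+ suc d) (sym (ℤ.*-identityʳ (ℤ.+ n)))
                (ℤ.+<+ (ℕ.<-≤-trans (ℕ.n<1+n n) (ℕ.m≤m*n (suc n) (suc d))))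

∣p-q∣≡∣q-p∣ : ∀ p q → ∣ p - q ∣ ≡ ∣ q - p ∣
∣p-q∣≡∣q-p∣ p q = begin
  ∣ p - q ∣      ≡⟨ ℚ.∣-p∣≡∣p∣ (p - q) ⟨
  ∣ - (p - q) ∣  ≡⟨ cong ∣_∣ (solve 2 (λ p q → :- (p :- q) := q :- p) refl p q) ⟩
  ∣ q - p ∣      ∎
  where
  open ≡-Reasoning
  open ℚ-Solver

∣p-r∣≤∣p-q∣+∣q-r∣ : ∀ p q r → ∣ p - r ∣ ≤ ∣ p - q ∣ + ∣ q - r ∣
∣p-r∣≤∣p-q∣+∣q-r∣ p q r = begin
  ∣ p - r ∣              ≡⟨ cong ∣_∣ (solve 3 (λ p q r → p :- r := (p :- q) :+ (q :- r)) refl p q r) ⟩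
  ∣ (p - q) + (q - r) ∣  ≤⟨ ℚ.∣p+q∣≤∣p∣+∣q∣ (p - q) (q - r) ⟩
  ∣ p - q ∣ + ∣ q - r ∣  ∎
  where
  open ℚ.≤-Reasoning
  open ℚ-Solver

w>0 : ∀ {n} (G : WGraph n) e → 0ℚ < w G e
w>0 G e = ℚ.<-≤-trans (ℚ.positive⁻¹ 1ℚ) (w≥1 G e)

∣winv*x∣*w≡∣x∣ : ∀ {n} (G : WGraph n) e x → ∣ winv G e * x ∣ * w G e ≡ ∣ x ∣
∣winv*x∣*w≡∣x∣ G e x = begin
  ∣ winv G e * x ∣ * w G e
    ≡⟨ cong (_* w G e) (ℚ.∣p*q∣≡∣p∣*∣q∣ (winv G e) x) ⟩
  ∣ winv G e ∣ * ∣ x ∣ * w G e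
    ≡⟨ cong (λ y → y * ∣ x ∣ * w G e) (ℚ.0≤p⇒∣p∣≡p 0≤winv) ⟩
  winv G e * ∣ x ∣ * w G e
    ≡⟨ solve 3 (λ i x w → i :* x :* w := x :* (i :* w)) refl (winv G e) ∣ x ∣ (w G e) ⟩
  ∣ x ∣ * (winv G e * w G e)
    ≡⟨ cong (∣ x ∣ *_) (ℚ.*-inverseˡ (w G e) {{>-nonZero (w>0 G e)}}) ⟩
  ∣ x ∣ * 1ℚ
    ≡⟨ ℚ.*-identityʳ ∣ x ∣ ⟩
  ∣ x ∣ ∎
  where
  open ≡-Reasoning
  open ℚ-Solver
  0≤winv : 0ℚ ≤ winv G e
  0≤winv = ℚ.<⇒≤ (ℚ.positive⁻¹ (winv G e) {{ℚ.1/pos⇒pos (w G e) {{positive (w>0 G e)}}}})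

src≢tgt : ∀ {n} (G : WGraph n) e → src G e ≢ tgt G e
src≢tgt G e = <⇒≢ (src<tgt G e)

edge : ∀ {n} (G : WGraph n) e → Walk G (src G e) (tgt G e)
edge G e = fwd∷_ {e = e} []

len-edge : ∀ {n} (G : WGraph n) e → len (edge G e) ≡ w G e
len-edge G e = ℚ.+-identityʳ (w G e)

B≡δ-δ : ∀ {n} (G : WGraph n) v e → B G v e ≡ δ (src G e) v - δ (tgt G e) v
B≡δ-δ G v e with src G e ≟ v | tgt G e ≟ v
... | yes refl | yes t≡s = ⊥-elim (src≢tgt G e (sym t≡s))
... | yes _    | no  _   = refl
... | no  _    | yes _   = refl
... | no  _    | no  _   = refl

Bᵀφ≡φ-φ : ∀ {n} (G : WGraph n) φ e → Bᵀφ G φ e ≡ φ (src G e) - φ (tgt G e)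
Bᵀφ≡φ-φ {n} G φ e = begin
  Σᶠ n (λ v → B G v e * φ v)
    ≡⟨ Σᶠ-cong n (λ v → cong (_* φ v) (B≡δ-δ G v e)) ⟩
  Σᶠ n (λ v → (δ s v - δ t v) * φ v)
    ≡⟨ Σᶠ-cong n (λ v → solve 3 (λ a b f → (a :- b) :* f := f :* a :- f :* b) refl (δ s v) (δ t v) (φ v)) ⟩
  Σᶠ n (λ v → φ v * δ s v - φ v * δ t v)
    ≡⟨ Σᶠ-distrib‿- n _ _ ⟩
  Σᶠ n (λ v → φ v * δ s v) - Σᶠ n (λ v → φ v * δ t v)
    ≡⟨ cong₂ _-_ (Σᶠ-δ n s φ) (Σᶠ-δ n t φ) ⟩
  φ s - φ t ∎
  where
  open ≡-Reasoning
  open ℚ-Solver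
  s = src G e
  t = tgt G e

-- Walks of bounded length

module _ {n} {G : WGraph n} where

  steps : ∀ {u v} → Walk G u v → ℕ
  steps []       = 0
  steps (fwd∷ p) = suc (steps p)
  steps (bwd∷ p) = suc (steps p)

  steps≤len : ∀ {u v} (p : Walk G u v) → ℕtoℚ (steps p) ≤ len p
  steps≤len []            = ≤-refl
  steps≤len (fwd∷_ {e} p) = +-mono-≤ (w≥1 G e) (steps≤len p)
  steps≤len (bwd∷_ {e} p) = +-mono-≤ (w≥1 G e) (steps≤len p)

  len-nonNeg : ∀ {u v} (p : Walk G u v) → 0ℚ ≤ len p
  len-nonNeg p = ≤-trans (ℕtoℚ-nonNeg (steps p)) (steps≤len p)

  len-pos : ∀ {u v} → u ≢ v → (p : Walk G u v) → 0ℚ < len p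
  len-pos u≢u []            = ⊥-elim (u≢u refl)
  len-pos _   (fwd∷_ {e} p) = ℚ.+-mono-<-≤ {0ℚ} (w>0 G e) (len-nonNeg p)
  len-pos _   (bwd∷_ {e} p) = ℚ.+-mono-<-≤ {0ℚ} (w>0 G e) (len-nonNeg p)

  steps-bound : ∀ L → ∃ λ N → ∀ {u v} (p : Walk G u v) → len p ≤ L → steps p ℕ.≤ N
  steps-bound L = N , λ p p≤L → ℕ.<⇒≤ (ℕtoℚ-cancel-< (ℚ.≤-<-trans (≤-trans (steps≤len p) p≤L) L<N))
    where
    N   = proj₁ (archimedean L)
    L<N = proj₂ (archimedean L)

module _ {n} (G : WGraph n) where

  trivialWalks : ∀ u v → List (Walk G u v)
  trivialWalks u v with u ≟ v
  ... | yes refl = [ [] ]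
  ... | no  _    = []

  mutual
    walks : ℕ → ∀ u v → List (Walk G u v)
    walks zero    u v = trivialWalks u v
    walks (suc N) u v =
      trivialWalks u v ++ concatMap (λ e → walksFwd N u v e ++ walksBwd N u v e) (allFin (m G))

    walksFwd : ℕ → ∀ u v → Fin (m G) → List (Walk G u v)
    walksFwd N u v e with src G e ≟ u
    ... | yes refl = map (fwd∷_ {e = e}) (walks N (tgt G e) v)
    ... | no  _    = []

    walksBwd : ℕ → ∀ u v → Fin (m G) → List (Walk G u v)
    walksBwd N u v e with tgt G e ≟ u
    ... | yes refl = map (bwd∷_ {e = e}) (walks N (src G e) v)
    ... | no  _    = []

  []∈trivialWalks : ∀ u → [] ∈ trivialWalks u u
  []∈trivialWalks u with u ≟ u
  ... | yes refl = here refl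
  ... | no  u≢u  = ⊥-elim (u≢u refl)

  mutual
    ∈-walks : ∀ {N u v} (p : Walk G u v) → steps p ℕ.≤ N → p ∈ walks N u v
    ∈-walks {zero}  []            _         = []∈trivialWalks _
    ∈-walks {suc N} []            _         = ∈-++⁺ˡ ([]∈trivialWalks _)
    ∈-walks {suc N} (fwd∷_ {e} p) (s≤s p≤N) =
      ∈-++⁺ʳ _ (∈-concatMap⁺ _ (lose (∈-allFin e) (∈-++⁺ˡ (∈-walksFwd p p≤N))))
    ∈-walks {suc N} (bwd∷_ {e} p) (s≤s p≤N) =
      ∈-++⁺ʳ _ (∈-concatMap⁺ _ (lose (∈-allFin e) (∈-++⁺ʳ _ (∈-walksBwd p p≤N))))

    ∈-walksFwd : ∀ {N e v} (p : Walk G (tgt G e) v) → steps p ℕ.≤ N →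
                 fwd∷_ {e = e} p ∈ walksFwd N (src G e) v e
    ∈-walksFwd {e = e} p p≤N with src G e ≟ src G e
    ... | yes refl = ∈-map⁺ _ (∈-walks p p≤N)
    ... | no  s≢s  = ⊥-elim (s≢s refl)

    ∈-walksBwd : ∀ {N e v} (p : Walk G (src G e) v) → steps p ℕ.≤ N →
                 bwd∷_ {e = e} p ∈ walksBwd N (tgt G e) v e
    ∈-walksBwd {e = e} p p≤N with tgt G e ≟ tgt G e
    ... | yes refl = ∈-map⁺ _ (∈-walks p p≤N)
    ... | no  t≢t  = ⊥-elim (t≢t refl)

  walksWithin : ℚ → ∀ u v → List (Walk G u v)
  walksWithin L = walks (proj₁ (steps-bound {G = G} L))

  ∈-walksWithin : ∀ {L u v} (p : Walk G u v) → len p ≤ L → p ∈ walksWithin L u v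
  ∈-walksWithin {L} p p≤L = ∈-walks p (proj₂ (steps-bound {G = G} L) p p≤L)

  walkWithin? : ∀ L u v → Dec (Σ (Walk G u v) λ p → len p ≤ L)
  walkWithin? L u v = map′ Any.satisfied (λ (p , p≤L) → lose (∈-walksWithin p p≤L) p≤L)
                           (any? (λ p → len p ℚ.≤? L) (walksWithin L u v))

  shortestWalk : ∀ {u v} → Walk G u v → Σ (Walk G u v) λ p → ∀ q → len p ≤ len q
  shortestWalk {u} {v} p₀ = p , minimal
    where
    candidates = walksWithin (len p₀) u v
    p = argmin len p₀ candidates
    minimal : ∀ q → len p ≤ len q
    minimal q with ℚ.≤-total (len q) (len p₀)
    ... | inj₁ q≤p₀ = All.lookup (f[argmin]≤f[xs] {f = len} p₀ candidates) (∈-walksWithin q q≤p₀)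
    ... | inj₂ p₀≤q = ≤-trans (f[argmin]≤f[⊤] {f = len} p₀ candidates) p₀≤q

  shortestWalk-isDist : ∀ {u v} (p₀ : Walk G u v) → IsDist G u v (fin (len (proj₁ (shortestWalk p₀))))
  shortestWalk-isDist p₀ = (proj₁ (shortestWalk p₀) , refl) , proj₂ (shortestWalk p₀)

-- The emulator hypothesis only speaks about distances, which exist only once a walk is known;
-- so each transfer is first proved under double negation, which the decidability of
-- walkWithin? then removes.

module _ {n} {G H : WGraph n} {β : ℚ} (emulator : IsEmulator β G H) {u v : Fin n} where

  shorterWalk : (h : Walk H u v) → Σ (Walk G u v) λ g → len g ≤ len h
  shorterWalk h = decidable-stable (walkWithin? G (len h) u v) ¬¬shorterWalk
    where
    dist-h* = shortestWalk-isDist H h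

    shorterWalk-from : Walk G u v → Σ (Walk G u v) λ g → len g ≤ len h
    shorterWalk-from g with emulator u v _ _ (shortestWalk-isDist G g) dist-h*
    ... | fin≤fin g*≤h* , _ = proj₁ (shortestWalk G g) , ≤-trans g*≤h* (proj₂ (shortestWalk H h) h)

    ¬¬shorterWalk : ¬ ¬ Σ (Walk G u v) λ g → len g ≤ len h
    ¬¬shorterWalk none with emulator u v ∞ _ (none ∘ shorterWalk-from) dist-h*
    ... | () , _

  stretchedWalk : u ≢ v → (g : Walk G u v) → Σ (Walk H u v) λ h → len h ≤ β * len g
  stretchedWalk u≢v g = decidable-stable (walkWithin? H (β * len g) u v) ¬¬stretchedWalk
    where
    g*      = proj₁ (shortestWalk G g)
    dist-g* = shortestWalk-isDist G g

    stretchedWalk-from : Walk H u v → Σ (Walk H u v) λ h → len h ≤ β * len g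
    stretchedWalk-from h with emulator u v _ _ dist-g* (shortestWalk-isDist H h)
    ... | fin≤fin g*≤h* , fin≤fin h*≤βg* = proj₁ (shortestWalk H h) , ≤-trans h*≤βg* βg*≤βg
      where
      1≤β : 1ℚ ≤ β
      1≤β = ℚ.*-cancelʳ-≤-pos (len g*) {{positive (len-pos u≢v g*)}}
              (≤-trans (≤-reflexive (ℚ.*-identityˡ (len g*))) (≤-trans g*≤h* h*≤βg*))
      βg*≤βg : β * len g* ≤ β * len g
      βg*≤βg = ℚ.*-monoˡ-≤-nonNeg β {{nonNegative (≤-trans (ℚ.nonNegative⁻¹ 1ℚ) 1≤β)}}
                 (proj₂ (shortestWalk G g) g)

    ¬¬stretchedWalk : ¬ ¬ Σ (Walk H u v) λ h → len h ≤ β * len g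
    ¬¬stretchedWalk none with emulator u v _ ∞ dist-g* (none ∘ stretchedWalk-from)
    ... | _ , ()

-- Potentials

Lipschitz : ∀ {n} → WGraph n → ℚ → Vec⟨V⟩ n → Set
Lipschitz G α φ = ∀ e → ∣ φ (src G e) - φ (tgt G e) ∣ ≤ α * w G e

∥W⁻¹Bᵀφ∥∞≤⇔Lipschitz : ∀ {n} (G : WGraph n) α φ →
                       (∥ W⁻¹ G (Bᵀφ G φ) ∥∞≤ α) ⇔ Lipschitz G α φ
∥W⁻¹Bᵀφ∥∞≤⇔Lipschitz G α φ = mk⇔
  (λ bounded e → subst (_≤ α * w G e) (∣winv*Bᵀφ∣*w≡∣Δφ∣ e)
                   (ℚ.*-monoʳ-≤-nonNeg (w G e) {{nonNegative (ℚ.<⇒≤ (w>0 G e))}} (bounded e)))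
  (λ lipschitz e → ℚ.*-cancelʳ-≤-pos (w G e) {{positive (w>0 G e)}}
                     (subst (_≤ α * w G e) (sym (∣winv*Bᵀφ∣*w≡∣Δφ∣ e)) (lipschitz e)))
  where
  ∣winv*Bᵀφ∣*w≡∣Δφ∣ : ∀ e →
                      ∣ winv G e * Bᵀφ G φ e ∣ * w G e ≡ ∣ φ (src G e) - φ (tgt G e) ∣
  ∣winv*Bᵀφ∣*w≡∣Δφ∣ e = trans (∣winv*x∣*w≡∣x∣ G e _) (cong ∣_∣ (Bᵀφ≡φ-φ G φ e))

Lipschitz-walk : ∀ {n} {G : WGraph n} α φ → Lipschitz G α φ →
                 ∀ {u v} (p : Walk G u v) → ∣ φ u - φ v ∣ ≤ α * len p
Lipschitz-walk α φ lipschitz {u} [] = ≤-reflexive (begin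
  ∣ φ u - φ u ∣  ≡⟨ cong ∣_∣ (ℚ.+-inverseʳ (φ u)) ⟩
  0ℚ             ≡⟨ ℚ.*-zeroʳ α ⟨
  α * 0ℚ         ∎)
  where open ≡-Reasoning
Lipschitz-walk {G = G} α φ lipschitz {v = v} (fwd∷_ {e} p) = begin
  ∣ φ s - φ v ∣                  ≤⟨ ∣p-r∣≤∣p-q∣+∣q-r∣ (φ s) (φ t) (φ v) ⟩
  ∣ φ s - φ t ∣ + ∣ φ t - φ v ∣  ≤⟨ +-mono-≤ (lipschitz e) (Lipschitz-walk α φ lipschitz p) ⟩
  α * w G e + α * len p          ≡⟨ ℚ.*-distribˡ-+ α (w G e) (len p) ⟨
  α * (w G e + len p)            ∎
  where
  open ℚ.≤-Reasoning
  s = src G e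
  t = tgt G e
Lipschitz-walk {G = G} α φ lipschitz {v = v} (bwd∷_ {e} p) = begin
  ∣ φ t - φ v ∣                  ≤⟨ ∣p-r∣≤∣p-q∣+∣q-r∣ (φ t) (φ s) (φ v) ⟩
  ∣ φ t - φ s ∣ + ∣ φ s - φ v ∣  ≡⟨ cong (_+ ∣ φ s - φ v ∣) (∣p-q∣≡∣q-p∣ (φ t) (φ s)) ⟩
  ∣ φ s - φ t ∣ + ∣ φ s - φ v ∣  ≤⟨ +-mono-≤ (lipschitz e) (Lipschitz-walk α φ lipschitz p) ⟩
  α * w G e + α * len p          ≡⟨ ℚ.*-distribˡ-+ α (w G e) (len p) ⟨
  α * (w G e + len p)            ∎
  where
  open ℚ.≤-Reasoning
  s = src G e
  t = tgt G e

Lipschitz-emulator : ∀ {n} {G H : WGraph n} {β} → IsEmulator β G H →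
                     ∀ α φ → Lipschitz H α φ → Lipschitz G (α * β) φ
Lipschitz-emulator {G = G} {β = β} emulator α φ lipschitz e = begin
  ∣ φ (src G e) - φ (tgt G e) ∣  ≤⟨ Lipschitz-walk α φ lipschitz h ⟩
  α * len h                      ≤⟨ ℚ.*-monoˡ-≤-nonNeg α {{nonNegative 0≤α}} h≤βe ⟩
  α * (β * len (edge G e))       ≡⟨ cong (λ l → α * (β * l)) (len-edge G e) ⟩
  α * (β * w G e)                ≡⟨ ℚ.*-assoc α β (w G e) ⟨
  α * β * w G e                  ∎
  where
  open ℚ.≤-Reasoning
  h    = proj₁ (stretchedWalk emulator (src≢tgt G e) (edge G e))
  h≤βe = proj₂ (stretchedWalk emulator (src≢tgt G e) (edge G e))
  -- α is not assumed nonnegative: 0 ≤ ∣Δφ∣ ≤ α * len h with len h > 0 forces it.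
  0≤α : 0ℚ ≤ α
  0≤α = ℚ.*-cancelʳ-≤-pos (len h) {{positive (len-pos (src≢tgt G e) h)}}
          (≤-trans (≤-reflexive (ℚ.*-zeroˡ (len h)))
                   (≤-trans (ℚ.0≤∣p∣ _) (Lipschitz-walk α φ lipschitz h)))

potentialBound-emulator : ∀ {n} {G H : WGraph n} {β} → IsEmulator β G H → ∀ α φ →
                          ∥ W⁻¹ H (Bᵀφ H φ) ∥∞≤ α → ∥ W⁻¹ G (Bᵀφ G φ) ∥∞≤ (α * β)
potentialBound-emulator {G = G} {H} {β} emulator α φ =
  Equivalence.from (∥W⁻¹Bᵀφ∥∞≤⇔Lipschitz G (α * β) φ)
  ∘ Lipschitz-emulator emulator α φ
  ∘ Equivalence.to (∥W⁻¹Bᵀφ∥∞≤⇔Lipschitz H α φ)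

-- Flows

module _ {n} (G : WGraph n) where

  Bf-zero : ∀ v → Bf G (λ _ → 0ℚ) v ≡ 0ℚ
  Bf-zero v = trans (Σᶠ-cong (m G) (λ i → ℚ.*-zeroʳ (B G v i))) (Σᶠ-zero (m G))

  Bf-+ : ∀ f g v → Bf G (λ i → f i + g i) v ≡ Bf G f v + Bf G g v
  Bf-+ f g v = trans (Σᶠ-cong (m G) (λ i → ℚ.*-distribˡ-+ (B G v i) (f i) (g i)))
                     (Σᶠ-distrib-+ (m G) _ _)

  Bf-neg : ∀ f v → Bf G (λ i → - f i) v ≡ - Bf G f v
  Bf-neg f v = trans (Σᶠ-cong (m G) (λ i → sym (ℚ.neg-distribʳ-* (B G v i) (f i))))
                     (Σᶠ-neg (m G) _)

  Bf-δ : ∀ e v → Bf G (δ e) v ≡ B G v e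
  Bf-δ e v = Σᶠ-δ (m G) e (B G v)

  Bf-Σᶠ : ∀ k (c : Fin k → ℚ) (f : Fin k → Vec⟨E⟩ G) v →
          Bf G (λ i → Σᶠ k (λ j → c j * f j i)) v ≡ Σᶠ k (λ j → c j * Bf G (f j) v)
  Bf-Σᶠ k c f v = begin
    Σᶠ (m G) (λ i → B G v i * Σᶠ k (λ j → c j * f j i))
      ≡⟨ Σᶠ-cong (m G) (λ i → *-distribˡ-Σᶠ k (B G v i) _) ⟩
    Σᶠ (m G) (λ i → Σᶠ k (λ j → B G v i * (c j * f j i)))
      ≡⟨ Σᶠ-comm (m G) k _ ⟩
    Σᶠ k (λ j → Σᶠ (m G) (λ i → B G v i * (c j * f j i)))
      ≡⟨ Σᶠ-cong k (λ j → Σᶠ-cong (m G) (λ i →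
           solve 3 (λ b c f → b :* (c :* f) := c :* (b :* f)) refl (B G v i) (c j) (f j i))) ⟩
    Σᶠ k (λ j → Σᶠ (m G) (λ i → c j * (B G v i * f j i)))
      ≡⟨ Σᶠ-cong k (λ j → *-distribˡ-Σᶠ (m G) (c j) _) ⟨
    Σᶠ k (λ j → c j * Bf G (f j) v) ∎
    where
    open ≡-Reasoning
    open ℚ-Solver

  cost-zero : cost G (λ _ → 0ℚ) ≡ 0ℚ
  cost-zero = trans (Σᶠ-cong (m G) (λ i → cong ∣_∣ (ℚ.*-zeroʳ (w G i)))) (Σᶠ-zero (m G))

  cost-+ : ∀ f g → cost G (λ i → f i + g i) ≤ cost G f + cost G g
  cost-+ f g = begin
    Σᶠ (m G) (λ i → ∣ w G i * (f i + g i) ∣)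
      ≡⟨ Σᶠ-cong (m G) (λ i → cong ∣_∣ (ℚ.*-distribˡ-+ (w G i) (f i) (g i))) ⟩
    Σᶠ (m G) (λ i → ∣ w G i * f i + w G i * g i ∣)
      ≤⟨ Σᶠ-mono-≤ (m G) (λ i → ℚ.∣p+q∣≤∣p∣+∣q∣ (w G i * f i) (w G i * g i)) ⟩
    Σᶠ (m G) (λ i → ∣ w G i * f i ∣ + ∣ w G i * g i ∣)
      ≡⟨ Σᶠ-distrib-+ (m G) _ _ ⟩
    cost G f + cost G g ∎
    where open ℚ.≤-Reasoning

  cost-neg : ∀ f → cost G (λ i → - f i) ≡ cost G f
  cost-neg f = Σᶠ-cong (m G) (λ i →
    trans (cong ∣_∣ (sym (ℚ.neg-distribʳ-* (w G i) (f i)))) (ℚ.∣-p∣≡∣p∣ _))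

  cost-δ : ∀ e → cost G (δ e) ≡ w G e
  cost-δ e = trans (Σᶠ-cong (m G) ∣w*δ∣≡w*δ) (Σᶠ-δ (m G) e (w G))
    where
    ∣w*δ∣≡w*δ : ∀ i → ∣ w G i * δ e i ∣ ≡ w G i * δ e i
    ∣w*δ∣≡w*δ i = trans (ℚ.∣p*q∣≡∣p∣*∣q∣ (w G i) (δ e i))
                        (cong₂ _*_ (ℚ.0≤p⇒∣p∣≡p (ℚ.<⇒≤ (w>0 G i))) (∣δ∣ e i))

  cost-Σᶠ : ∀ k (c : Fin k → ℚ) (f : Fin k → Vec⟨E⟩ G) →
            cost G (λ i → Σᶠ k (λ j → c j * f j i)) ≤ Σᶠ k (λ j → ∣ c j ∣ * cost G (f j))
  cost-Σᶠ k c f = begin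
    Σᶠ (m G) (λ i → ∣ w G i * Σᶠ k (λ j → c j * f j i) ∣)
      ≡⟨ Σᶠ-cong (m G) (cong ∣_∣ ∘ w*Σᶠ≡Σᶠ) ⟩
    Σᶠ (m G) (λ i → ∣ Σᶠ k (λ j → c j * (w G i * f j i)) ∣)
      ≤⟨ Σᶠ-mono-≤ (m G) (λ i → ∣Σᶠ∣≤Σᶠ∣∣ k _) ⟩
    Σᶠ (m G) (λ i → Σᶠ k (λ j → ∣ c j * (w G i * f j i) ∣))
      ≡⟨ Σᶠ-cong (m G) (λ i → Σᶠ-cong k (λ j → ℚ.∣p*q∣≡∣p∣*∣q∣ (c j) _)) ⟩
    Σᶠ (m G) (λ i → Σᶠ k (λ j → ∣ c j ∣ * ∣ w G i * f j i ∣))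
      ≡⟨ Σᶠ-comm (m G) k _ ⟩
    Σᶠ k (λ j → Σᶠ (m G) (λ i → ∣ c j ∣ * ∣ w G i * f j i ∣))
      ≡⟨ Σᶠ-cong k (λ j → *-distribˡ-Σᶠ (m G) ∣ c j ∣ _) ⟨
    Σᶠ k (λ j → ∣ c j ∣ * cost G (f j)) ∎
    where
    open ℚ.≤-Reasoning
    w*Σᶠ≡Σᶠ : ∀ i → w G i * Σᶠ k (λ j → c j * f j i) ≡ Σᶠ k (λ j → c j * (w G i * f j i))
    w*Σᶠ≡Σᶠ i = trans (*-distribˡ-Σᶠ k (w G i) _) (Σᶠ-cong k (λ j →
      solve 3 (λ w c f → w :* (c :* f) := c :* (w :* f)) refl (w G i) (c j) (f j i)))
      where open ℚ-Solver

  walkFlow : ∀ {u v} → Walk G u v → Vec⟨E⟩ G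
  walkFlow []            _ = 0ℚ
  walkFlow (fwd∷_ {e} p) i = δ e i + walkFlow p i
  walkFlow (bwd∷_ {e} p) i = - δ e i + walkFlow p i

  walkFlow-routes : ∀ {u v} (p : Walk G u v) → Routes G (walkFlow p) (λ x → δ u x - δ v x)
  walkFlow-routes {u} [] x = trans (Bf-zero x) (sym (ℚ.+-inverseʳ (δ u x)))
  walkFlow-routes {v = v} (fwd∷_ {e} p) x = begin
    Bf G (λ i → δ e i + walkFlow p i) x
      ≡⟨ Bf-+ (δ e) (walkFlow p) x ⟩
    Bf G (δ e) x + Bf G (walkFlow p) x
      ≡⟨ cong₂ _+_ (trans (Bf-δ e x) (B≡δ-δ G x e)) (walkFlow-routes p x) ⟩
    (δ s x - δ t x) + (δ t x - δ v x)
      ≡⟨ solve 3 (λ a b c → (a :- b) :+ (b :- c) := a :- c) refl (δ s x) (δ t x) (δ v x) ⟩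
    δ s x - δ v x ∎
    where
    open ≡-Reasoning
    open ℚ-Solver
    s = src G e
    t = tgt G e
  walkFlow-routes {v = v} (bwd∷_ {e} p) x = begin
    Bf G (λ i → - δ e i + walkFlow p i) x
      ≡⟨ Bf-+ (λ i → - δ e i) (walkFlow p) x ⟩
    Bf G (λ i → - δ e i) x + Bf G (walkFlow p) x
      ≡⟨ cong₂ _+_ (trans (Bf-neg (δ e) x) (cong -_ (trans (Bf-δ e x) (B≡δ-δ G x e)))) (walkFlow-routes p x) ⟩
    - (δ s x - δ t x) + (δ s x - δ v x)
      ≡⟨ solve 3 (λ a b c → :- (a :- b) :+ (a :- c) := b :- c) refl (δ s x) (δ t x) (δ v x) ⟩
    δ t x - δ v x ∎
    where
    open ≡-Reasoning
    open ℚ-Solver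
    s = src G e
    t = tgt G e

  walkFlow-cost : ∀ {u v} (p : Walk G u v) → cost G (walkFlow p) ≤ len p
  walkFlow-cost []            = ≤-reflexive cost-zero
  walkFlow-cost (fwd∷_ {e} p) = begin
    cost G (λ i → δ e i + walkFlow p i)           ≤⟨ cost-+ (δ e) (walkFlow p) ⟩
    cost G (δ e) + cost G (walkFlow p)            ≤⟨ +-mono-≤ (≤-reflexive (cost-δ e)) (walkFlow-cost p) ⟩
    w G e + len p                                 ∎
    where open ℚ.≤-Reasoning
  walkFlow-cost (bwd∷_ {e} p) = begin
    cost G (λ i → - δ e i + walkFlow p i)
      ≤⟨ cost-+ (λ i → - δ e i) (walkFlow p) ⟩
    cost G (λ i → - δ e i) + cost G (walkFlow p)
      ≤⟨ +-mono-≤ (≤-reflexive (trans (cost-neg (δ e)) (cost-δ e))) (walkFlow-cost p) ⟩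
    w G e + len p ∎
    where open ℚ.≤-Reasoning

reroute : ∀ {n} {G H : WGraph n} →
          (∀ e → Σ (Walk G (src H e) (tgt H e)) λ p → len p ≤ w H e) →
          ∀ {d} (f : Vec⟨E⟩ H) → Routes H f d →
          Σ (Vec⟨E⟩ G) λ g → Routes G g d × (cost G g ≤ cost H f)
reroute {G = G} {H} path {d} f f-routes = g , g-routes , g-cost
  where
  flowOf : Fin (m H) → Vec⟨E⟩ G
  flowOf e = walkFlow G (proj₁ (path e))

  g : Vec⟨E⟩ G
  g i = Σᶠ (m H) (λ e → f e * flowOf e i)

  g-routes : Routes G g d
  g-routes x = begin
    Bf G g x
      ≡⟨ Bf-Σᶠ G (m H) f flowOf x ⟩
    Σᶠ (m H) (λ e → f e * Bf G (flowOf e) x)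
      ≡⟨ Σᶠ-cong (m H) (λ e → cong (f e *_) (flowOf-routes e x)) ⟩
    Σᶠ (m H) (λ e → f e * B H x e)
      ≡⟨ Σᶠ-cong (m H) (λ e → ℚ.*-comm (f e) (B H x e)) ⟩
    Bf H f x
      ≡⟨ f-routes x ⟩
    d x ∎
    where
    open ≡-Reasoning
    flowOf-routes : ∀ e x → Bf G (flowOf e) x ≡ B H x e
    flowOf-routes e x = trans (walkFlow-routes G (proj₁ (path e)) x) (sym (B≡δ-δ H x e))

  g-cost : cost G g ≤ cost H f
  g-cost = begin
    cost G g
      ≤⟨ cost-Σᶠ G (m H) f flowOf ⟩
    Σᶠ (m H) (λ e → ∣ f e ∣ * cost G (flowOf e))
      ≤⟨ Σᶠ-mono-≤ (m H) (λ e → ℚ.*-monoˡ-≤-nonNeg ∣ f e ∣ {{ℚ.∣-∣-nonNeg (f e)}} (flowOf-cost e)) ⟩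
    Σᶠ (m H) (λ e → ∣ f e ∣ * w H e)
      ≡⟨ Σᶠ-cong (m H) ∣f∣*w≡∣w*f∣ ⟩
    cost H f ∎
    where
    open ℚ.≤-Reasoning
    flowOf-cost : ∀ e → cost G (flowOf e) ≤ w H e
    flowOf-cost e = ≤-trans (walkFlow-cost G (proj₁ (path e))) (proj₂ (path e))
    ∣f∣*w≡∣w*f∣ : ∀ e → ∣ f e ∣ * w H e ≡ ∣ w H e * f e ∣
    ∣f∣*w≡∣w*f∣ e = begin-equality
      ∣ f e ∣ * w H e      ≡⟨ ℚ.*-comm ∣ f e ∣ (w H e) ⟩
      w H e * ∣ f e ∣      ≡⟨ cong (_* ∣ f e ∣) (ℚ.0≤p⇒∣p∣≡p (ℚ.<⇒≤ (w>0 H e))) ⟨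
      ∣ w H e ∣ * ∣ f e ∣  ≡⟨ ℚ.∣p*q∣≡∣p∣*∣q∣ (w H e) (f e) ⟨
      ∣ w H e * f e ∣      ∎

cheapFlow-emulator : ∀ {n} {G H : WGraph n} {β} → IsEmulator β G H → ∀ {d c} →
                     Σ (Vec⟨E⟩ H) (λ f → Routes H f d × (cost H f ≤ c)) →
                     Σ (Vec⟨E⟩ G) (λ g → Routes G g d × (cost G g ≤ c))
cheapFlow-emulator {G = G} {H} emulator {d} (f , f-routes , f≤c) =
  let (g , g-routes , g≤f) = reroute {G = G} {H} path {d} f f-routes
  in  g , g-routes , ≤-trans g≤f f≤c
  where
  path : ∀ e → Σ (Walk G (src H e) (tgt H e)) λ p → len p ≤ w H e
  path e = let (p , p≤e) = shorterWalk emulator (edge H e)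
           in  p , ≤-trans p≤e (≤-reflexive (len-edge H e))

theorem4p1 : ∀ {n : ℕ} (G H : WGraph n) (α β : ℚ) →
    IsEmulator β G H →
    (P : Precond n) →
    IsDualOnlyPrecond H α P →
    IsDualOnlyPrecond G (α * β) P
theorem4p1 G H α β emulator P precondH d proper =
  potentialBound-emulator {G = G} {H} emulator α (P d proper) (proj₁ (precondH d proper)) ,
  cheapFlow-emulator {G = G} {H} emulator (proj₂ (precondH d proper))
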